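{- Let $A$ be a commutative ring, $\mathcal{X}$ an alphabet, and let $R,L\in A^{\mathrm{rat}}\langle\langle\mathcal{X}\rangle\rangle$ be rational series such that $\langle R|1_{\mathcal{X}^*}\rangle=1_A$, $\langle L|1_{\mathcal{X}^*}\rangle=0$ and $L^*=R$. Then the following assertions are equivalent: (1) $R$ is a concatenation-character of $(A\langle\mathcal{X}\rangle,\cdot,1_{\mathcal{X}^*})$; (2) there is a family of coefficients $(c_x)_{x\in\mathcal{X}}$ in $A$ such that $R=\big(\sum_{x\in\mathcal{X}}c_xx\big)^*$; (3) $R$ admits a linear representation of dimension one; (4) $L$ belongs to the plane $A.\mathcal{X}$; (5) $L$ is an infinitesimal concatenation-character of $(A\langle\mathcal{X}\rangle,\cdot,1_{\mathcal{X}^*})$.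
   Context: $\mathcal{X}^*$ is the free monoid on $\mathcal{X}$ with empty word $1_{\mathcal{X}^*}$; $A\langle\mathcal{X}\rangle$ are noncommutative polynomials and $A\langle\langle\mathcal{X}\rangle\rangle$ formal series $S=\sum_w\langle S|w\rangle w$, with concatenation extended by the Cauchy product. For $S$ with $\langle S|1_{\mathcal{X}^*}\rangle=0$, $S^*=1+S+S^2+\cdots$. A linear representation of dimension $n$ of a series $S$ is a triple $(\nu,\mu,\eta)$ with $\nu\in M_{1,n}(A)$, $\eta\in M_{n,1}(A)$ and $\mu:\mathcal{X}^*\to M_{n,n}(A)$ a monoid morphism such that $\langle S|w\rangle=\nu\mu(w)\eta$ for all $w\in\mathcal{X}^*$; $S$ is rational iff it admits such a representation (equivalently, it lies in the closure of the homogeneous degree-one series under $+$, concatenation and star); $A^{\mathrm{rat}}\langle\langle\mathcal{X}\rangle\rangle$ denotes the set of rational series. The plane $A.\mathcal{X}$ is the set of series of the form $\sum_{x\in\mathcal{X}}a_xx$ with $a_x\in A$. A series $S$ is a concatenation-character if $\langle S|1_{\mathcal{X}^*}\rangle=1_A$ and $\langle S|uv\rangle=\langle S|u\rangle\langle S|v\rangle$ for all $u,v\in\mathcal{X}^*$; it is an infinitesimal concatenation-character if $\langle S|uv\rangle=\langle S|u\rangle\langle v|1_{\mathcal{X}^*}\rangle+\langle u|1_{\mathcal{X}^*}\rangle\langle S|v\rangle$ for all $u,v\in\mathcal{X}^*$ (where $\langle w|1_{\mathcal{X}^*}\rangle$ is $1$ if $w$ is the empty word and $0$ otherwise). -}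

module Defs where

open import Level using (Level; _⊔_)
open import Algebra.Bundles using (CommutativeRing)
open import Data.Nat using (ℕ; zero; suc)
open import Data.Fin using (Fin; zero; suc)
open import Data.List using (List; []; _∷_; _++_; length; map)
open import Data.Product using (Σ; ∃; _×_; _,_; proj₁; proj₂)

module Series {c ℓ : Level} (A : CommutativeRing c ℓ) (X : Set) where
  open CommutativeRing A hiding (zero)

  Ser : Set c
  Ser = List X → Carrier

  _≋_ : Ser → Ser → Set ℓ
  S ≋ T = ∀ w → S w ≈ T w

  δ : List X → Carrier
  δ []      = 1#
  δ (_ ∷ _) = 0#

  one : Ser
  one = δ

  sumL : List Carrier → Carrier
  sumL []       = 0#
  sumL (a ∷ as) = a + sumL as

  splits : List X → List (List X × List X)
  splits []       = ([] , []) ∷ []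
  splits (x ∷ w)  = ([] , x ∷ w) ∷ map (λ p → (x ∷ proj₁ p , proj₂ p)) (splits w)

  _·_ : Ser → Ser → Ser
  (S · T) w = sumL (map (λ p → S (proj₁ p) * T (proj₂ p)) (splits w))

  _^_ : Ser → ℕ → Ser
  S ^ zero  = one
  S ^ suc k = S · (S ^ k)

  powSum : Ser → ℕ → List X → Carrier
  powSum S zero    w = (S ^ zero) w
  powSum S (suc n) w = powSum S n w + (S ^ suc n) w

  -- Kleene star S* = Σ_k S^k, for S with ⟨S|1⟩ = 0 : the coefficient of w
  -- only involves the powers S^k with k ≤ |w| (the others vanish on w).
  star : Ser → Ser
  star S w = powSum S (length w) w

  sumF : (n : ℕ) → (Fin n → Carrier) → Carrier
  sumF zero    f = 0#
  sumF (suc n) f = f zero + sumF n (λ i → f (suc i))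

  Mat : ℕ → ℕ → Set c
  Mat m n = Fin m → Fin n → Carrier

  _⊗_ : {m n p : ℕ} → Mat m n → Mat n p → Mat m p
  _⊗_ {n = n} M N i k = sumF n (λ j → M i j * N j k)

  idM : (n : ℕ) → Mat n n
  idM (suc n) zero    zero    = 1#
  idM (suc n) zero    (suc j) = 0#
  idM (suc n) (suc i) zero    = 0#
  idM (suc n) (suc i) (suc j) = idM n i j

  μ* : {n : ℕ} → (X → Mat n n) → List X → Mat n n
  μ* {n} μ []      = idM n
  μ* {n} μ (x ∷ w) = μ x ⊗ μ* μ w

  record LinRep (n : ℕ) (S : Ser) : Set (c ⊔ ℓ) where
    field
      ν   : Mat 1 n
      μ   : X → Mat n n
      η   : Mat n 1
      rep : ∀ w → S w ≈ ((ν ⊗ μ* μ w) ⊗ η) zero zero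

  Rational : Ser → Set (c ⊔ ℓ)
  Rational S = Σ ℕ λ n → LinRep n S

  planeSer : (X → Carrier) → Ser
  planeSer a []          = 0#
  planeSer a (x ∷ [])    = a x
  planeSer a (_ ∷ _ ∷ _) = 0#

  InPlane : Ser → Set (c ⊔ ℓ)
  InPlane S = Σ (X → Carrier) λ a → S ≋ planeSer a

  IsConcChar : Ser → Set ℓ
  IsConcChar S = (S [] ≈ 1#) × (∀ u v → S (u ++ v) ≈ S u * S v)

  IsInfConcChar : Ser → Set ℓ
  IsInfConcChar S = ∀ u v → S (u ++ v) ≈ S u * δ v + δ u * S v

module Submission where

open import Defs
open import Level using (Level; _⊔_)
open import Algebra.Bundles using (CommutativeRing)
open import Data.List using ([])
open import Data.Product using (Σ; _×_)
open import Function.Bundles using (_⇔_)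

open import Data.List using (List; _∷_; _++_; length; map)
open import Data.List.Properties using (map-∘)
open import Data.List.Relation.Unary.All as All using (All; []; _∷_; universal)
open import Data.List.Relation.Unary.All.Properties using (map⁺)
open import Data.Nat using (zero; suc; _≤_; _<_; _≤′_; ≤′-refl; ≤′-step; z≤n; s≤s)
open import Data.Nat.Properties using (≤-refl; ≤-trans; ≤-<-trans; <-≤-trans; n≤1+n; ≤⇒≤′; ≤′⇒≤)
open import Data.Product using (_,_; proj₁; proj₂)
open import Data.Fin using () renaming (zero to fzero)
open import Function.Bundles using (mk⇔)
import Function.Properties.Equivalence as ⇔
import Relation.Binary.PropositionalEquality as ≡
import Relation.Binary.Reasoning.Setoid as SetoidReasoning
import Algebra.Properties.Group as GroupProperties
import Algebra.Properties.CommutativeSemigroup as CommutativeSemigroupProperties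

-- For a proper series S, coefficientwise S* = 1 + S S*, i.e.
--   S*(x w) = Σ_{w = u v} S(x u) S*(v).
-- In this expansion S(x w) occurs exactly once, multiplied by S*(1) = 1, while every
-- other term involves S only on shorter words; so S* determines S (star is injective
-- on proper series). For S = Σ c_x x only the term u = 1 survives, so
-- (Σ c_x x)*(w) = c_{x₁} ⋯ c_{xₙ}: the stars of planes are exactly the letter products,
-- i.e. the concatenation-characters, and also exactly the series with a 1-dimensional
-- representation. Injectivity of star transfers this to L, and L lies in A.X iff it
-- vanishes off the words of length one, which is the infinitesimal character law.

module Characters {c ℓ : Level} (A : CommutativeRing c ℓ) (X : Set) where
  open CommutativeRing A hiding (zero)
  open Series A X
  open SetoidReasoning setoid
  open GroupProperties +-group using (identityˡ-unique) renaming (∙-cancelˡ to +-cancelˡ)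
  open CommutativeSemigroupProperties +-commutativeSemigroup using (interchange)

  sumL-cong : ∀ {B : Set} {f g : B → Carrier} {xs : List B}
            → All (λ p → f p ≈ g p) xs → sumL (map f xs) ≈ sumL (map g xs)
  sumL-cong []       = refl
  sumL-cong (e ∷ es) = +-cong e (sumL-cong es)

  sumL-zero : ∀ {B : Set} {f : B → Carrier} {xs : List B}
            → All (λ p → f p ≈ 0#) xs → sumL (map f xs) ≈ 0#
  sumL-zero []       = refl
  sumL-zero (e ∷ es) = trans (+-cong e (sumL-zero es)) (+-identityˡ 0#)

  sumL-+ : ∀ {B : Set} (f g : B → Carrier) (xs : List B)
         → sumL (map f xs) + sumL (map g xs) ≈ sumL (map (λ p → f p + g p) xs)
  sumL-+ f g []       = +-identityˡ 0#
  sumL-+ f g (y ∷ ys) = trans (interchange _ _ _ _) (+-cong refl (sumL-+ f g ys))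

  sumL-map : ∀ {B C : Set} (f : C → Carrier) (g : B → C) (xs : List B)
           → sumL (map f (map g xs)) ≈ sumL (map (λ p → f (g p)) xs)
  sumL-map f g xs = reflexive (≡.cong sumL (≡.sym (map-∘ xs)))

  Split : Set
  Split = List X × List X

  consˡ : X → Split → Split
  consˡ x (u , v) = (x ∷ u , v)

  splits-suffix-length : ∀ w → All (λ p → length (proj₂ p) ≤ length w) (splits w)
  splits-suffix-length []      = z≤n ∷ []
  splits-suffix-length (x ∷ w) =
    ≤-refl ∷ map⁺ (All.map (λ le → ≤-trans le (n≤1+n _)) (splits-suffix-length w))

  -- The last splitting of w is (w , []); the sum over the others can be cancelled.
  sumL-splits-cancel : ∀ w (f g : Split → Carrier)
    → (∀ u v → length u < length w → f (u , v) ≈ g (u , v))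
    → sumL (map f (splits w)) ≈ sumL (map g (splits w))
    → f (w , []) ≈ g (w , [])
  sumL-splits-cancel [] f g _ sum≈ = trans (sym (+-identityʳ _)) (trans sum≈ (+-identityʳ _))
  sumL-splits-cancel (x ∷ w) f g shorter sum≈ =
    sumL-splits-cancel w (λ p → f (consˡ x p)) (λ p → g (consˡ x p))
      (λ u v lt → shorter (x ∷ u) v (s≤s lt))
      (+-cancelˡ (f ([] , x ∷ w)) _ _ (begin
         f ([] , x ∷ w) + sumL (map (λ p → f (consˡ x p)) (splits w))
           ≈⟨ +-cong refl (sym (sumL-map f (consˡ x) (splits w))) ⟩
         sumL (map f (splits (x ∷ w)))
           ≈⟨ sum≈ ⟩
         sumL (map g (splits (x ∷ w)))
           ≈⟨ +-cong (sym (shorter [] (x ∷ w) (s≤s z≤n))) (sumL-map g (consˡ x) (splits w)) ⟩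
         f ([] , x ∷ w) + sumL (map (λ p → g (consˡ x p)) (splits w)) ∎))

  ·-[] : ∀ S T → (S · T) [] ≈ S [] * T []
  ·-[] S T = +-identityʳ _

  ·-∷ : ∀ {S} T → S [] ≈ 0# → ∀ x w
      → (S · T) (x ∷ w) ≈ sumL (map (λ p → S (x ∷ proj₁ p) * T (proj₂ p)) (splits w))
  ·-∷ {S} T S[]≈0 x w = begin
    S [] * T (x ∷ w) + sumL (map (λ p → S (proj₁ p) * T (proj₂ p)) (map (consˡ x) (splits w)))
      ≈⟨ +-cong (trans (*-congʳ S[]≈0) (zeroˡ _)) (sumL-map _ (consˡ x) (splits w)) ⟩
    0# + sumL (map (λ p → S (x ∷ proj₁ p) * T (proj₂ p)) (splits w))
      ≈⟨ +-identityˡ _ ⟩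
    sumL (map (λ p → S (x ∷ proj₁ p) * T (proj₂ p)) (splits w)) ∎

  ^-vanishes : ∀ {S} → S [] ≈ 0# → ∀ k v → length v < k → (S ^ k) v ≈ 0#
  ^-vanishes {S} S[]≈0 (suc k) [] _ =
    trans (·-[] S (S ^ k)) (trans (*-congʳ S[]≈0) (zeroˡ _))
  ^-vanishes {S} S[]≈0 (suc k) (x ∷ v) (s≤s |v|<k) =
    trans (·-∷ (S ^ k) S[]≈0 x v)
      (sumL-zero (All.map
        (λ le → trans (*-congˡ (^-vanishes S[]≈0 k _ (≤-<-trans le |v|<k))) (zeroʳ _))
        (splits-suffix-length v)))

  ^-cong : ∀ {S T} → S ≋ T → ∀ k → (S ^ k) ≋ (T ^ k)
  ^-cong S≋T zero    w = refl
  ^-cong S≋T (suc k) w =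
    sumL-cong (universal (λ p → *-cong (S≋T (proj₁ p)) (^-cong S≋T k (proj₂ p))) (splits w))

  powSum-cong : ∀ {S T} → S ≋ T → ∀ n w → powSum S n w ≈ powSum T n w
  powSum-cong S≋T zero    w = refl
  powSum-cong S≋T (suc n) w = +-cong (powSum-cong S≋T n w) (^-cong S≋T (suc n) w)

  star-cong : ∀ {S T} → S ≋ T → star S ≋ star T
  star-cong S≋T w = powSum-cong S≋T (length w) w

  powSum-suc-∷ : ∀ {S} → S [] ≈ 0# → ∀ n x w
    → powSum S (suc n) (x ∷ w) ≈ sumL (map (λ p → S (x ∷ proj₁ p) * powSum S n (proj₂ p)) (splits w))
  powSum-suc-∷ {S} S[]≈0 zero x w = trans (+-identityˡ _) (·-∷ one S[]≈0 x w)
  powSum-suc-∷ {S} S[]≈0 (suc n) x w = begin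
    powSum S (suc n) (x ∷ w) + (S · (S ^ suc n)) (x ∷ w)
      ≈⟨ +-cong (powSum-suc-∷ S[]≈0 n x w) (·-∷ (S ^ suc n) S[]≈0 x w) ⟩
    sumL (map f (splits w)) + sumL (map g (splits w))
      ≈⟨ sumL-+ f g (splits w) ⟩
    sumL (map (λ p → f p + g p) (splits w))
      ≈⟨ sumL-cong (universal (λ _ → sym (distribˡ _ _ _)) (splits w)) ⟩
    sumL (map (λ p → S (x ∷ proj₁ p) * powSum S (suc n) (proj₂ p)) (splits w)) ∎
    where
    f g : Split → Carrier
    f p = S (x ∷ proj₁ p) * powSum S n (proj₂ p)
    g p = S (x ∷ proj₁ p) * (S ^ suc n) (proj₂ p)

  powSum-stable : ∀ {S} → S [] ≈ 0# → ∀ {v n} → length v ≤′ n → powSum S n v ≈ star S v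
  powSum-stable S[]≈0 ≤′-refl = refl
  powSum-stable S[]≈0 {v} (≤′-step le) =
    trans (+-cong (powSum-stable S[]≈0 le) (^-vanishes S[]≈0 _ v (s≤s (≤′⇒≤ le))))
          (+-identityʳ _)

  star-∷ : ∀ {S} → S [] ≈ 0# → ∀ x w
    → star S (x ∷ w) ≈ sumL (map (λ p → S (x ∷ proj₁ p) * star S (proj₂ p)) (splits w))
  star-∷ S[]≈0 x w =
    trans (powSum-suc-∷ S[]≈0 (length w) x w)
      (sumL-cong (All.map (λ le → *-congˡ (powSum-stable S[]≈0 (≤⇒≤′ le)))
                          (splits-suffix-length w)))

  star-injective : ∀ {S T} → S [] ≈ 0# → T [] ≈ 0# → star S ≋ star T → S ≋ T
  star-injective {S} {T} S[]≈0 T[]≈0 S*≋T* []      = trans S[]≈0 (sym T[]≈0)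
  star-injective {S} {T} S[]≈0 T[]≈0 S*≋T* (x ∷ w) = agree-below (suc (length w)) w ≤-refl
    where
    agree-below : ∀ n w → length w < n → S (x ∷ w) ≈ T (x ∷ w)
    agree-below (suc n) w (s≤s |w|≤n) =
      trans (sym (*-identityʳ _)) (trans S[xw]*1≈T[xw]*1 (*-identityʳ _))
      where
      S[xw]*1≈T[xw]*1 : S (x ∷ w) * 1# ≈ T (x ∷ w) * 1#
      S[xw]*1≈T[xw]*1 =
        sumL-splits-cancel w
          (λ p → S (x ∷ proj₁ p) * star S (proj₂ p))
          (λ p → T (x ∷ proj₁ p) * star T (proj₂ p))
          (λ u v lt → *-cong (agree-below n u (<-≤-trans lt |w|≤n)) (S*≋T* v))
          (trans (sym (star-∷ S[]≈0 x w)) (trans (S*≋T* (x ∷ w)) (star-∷ T[]≈0 x w)))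

  letterProduct : (X → Carrier) → Ser
  letterProduct a []      = 1#
  letterProduct a (x ∷ w) = a x * letterProduct a w

  letterProduct-++ : ∀ (a : X → Carrier) u v → letterProduct a (u ++ v) ≈ letterProduct a u * letterProduct a v
  letterProduct-++ a []      v = sym (*-identityˡ _)
  letterProduct-++ a (x ∷ u) v = trans (*-congˡ (letterProduct-++ a u v)) (sym (*-assoc _ _ _))

  IsLetterProduct : Ser → Set (c ⊔ ℓ)
  IsLetterProduct S = Σ (X → Carrier) λ a → S ≋ letterProduct a

  isConcChar⇔isLetterProduct : ∀ {S} → IsConcChar S ⇔ IsLetterProduct S
  isConcChar⇔isLetterProduct {S} = mk⇔ toProduct fromProduct
    where
    toProduct : IsConcChar S → IsLetterProduct S
    toProduct (S[]≈1 , S-++) = (λ x → S (x ∷ [])) , S≋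
      where
      S≋ : S ≋ letterProduct (λ x → S (x ∷ []))
      S≋ []      = S[]≈1
      S≋ (x ∷ w) = trans (S-++ (x ∷ []) w) (*-congˡ (S≋ w))
    fromProduct : IsLetterProduct S → IsConcChar S
    fromProduct (a , S≋) = S≋ [] , λ u v → begin
      S (u ++ v)                              ≈⟨ S≋ (u ++ v) ⟩
      letterProduct a (u ++ v)                ≈⟨ letterProduct-++ a u v ⟩
      letterProduct a u * letterProduct a v   ≈⟨ sym (*-cong (S≋ u) (S≋ v)) ⟩
      S u * S v                               ∎

  planeSer-splits : ∀ (a : X → Carrier) (T : Ser) x w
    → sumL (map (λ p → planeSer a (x ∷ proj₁ p) * T (proj₂ p)) (splits w)) ≈ a x * T w
  planeSer-splits a T x []      = +-identityʳ _
  planeSer-splits a T x (y ∷ w) =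
    trans (+-cong refl (trans (sumL-map (λ p → planeSer a (x ∷ proj₁ p) * T (proj₂ p)) (consˡ y) (splits w))
                              (sumL-zero (universal (λ _ → zeroˡ _) (splits w)))))
          (+-identityʳ _)

  star-planeSer : ∀ (a : X → Carrier) → star (planeSer a) ≋ letterProduct a
  star-planeSer a []      = refl
  star-planeSer a (x ∷ w) = begin
    star (planeSer a) (x ∷ w)                ≈⟨ star-∷ refl x w ⟩
    sumL (map (λ p → planeSer a (x ∷ proj₁ p) * star (planeSer a) (proj₂ p)) (splits w))
                                             ≈⟨ planeSer-splits a (star (planeSer a)) x w ⟩
    a x * star (planeSer a) w                ≈⟨ *-congˡ (star-planeSer a w) ⟩
    a x * letterProduct a w                  ∎

  starOfPlane⇔isLetterProduct : ∀ {S}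
    → (Σ (X → Carrier) λ a → S ≋ star (planeSer a)) ⇔ IsLetterProduct S
  starOfPlane⇔isLetterProduct = mk⇔
    (λ (a , S≋) → a , λ w → trans (S≋ w) (star-planeSer a w))
    (λ (a , S≋) → a , λ w → trans (S≋ w) (sym (star-planeSer a w)))

  ⊗-inner₁ : ∀ {m p} (M : Mat m 1) (N : Mat 1 p) i k → (M ⊗ N) i k ≈ M i fzero * N fzero k
  ⊗-inner₁ M N i k = +-identityʳ _

  μ*-dim₁ : ∀ (μ : X → Mat 1 1) w → μ* μ w fzero fzero ≈ letterProduct (λ x → μ x fzero fzero) w
  μ*-dim₁ μ []      = refl
  μ*-dim₁ μ (x ∷ w) = trans (⊗-inner₁ (μ x) (μ* μ w) fzero fzero) (*-congˡ (μ*-dim₁ μ w))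

  linRep-dim₁ : ∀ (ν : Mat 1 1) (μ : X → Mat 1 1) (η : Mat 1 1) w
    → ((ν ⊗ μ* μ w) ⊗ η) fzero fzero
      ≈ (ν fzero fzero * letterProduct (λ x → μ x fzero fzero) w) * η fzero fzero
  linRep-dim₁ ν μ η w =
    trans (⊗-inner₁ (ν ⊗ μ* μ w) η fzero fzero)
          (*-congʳ (trans (⊗-inner₁ ν (μ* μ w) fzero fzero) (*-congˡ (μ*-dim₁ μ w))))

  linRep₁-scaled : ∀ {S} (r : LinRep 1 S)
    → S ≋ λ w → S [] * letterProduct (λ x → LinRep.μ r x fzero fzero) w
  linRep₁-scaled {S} r w = begin
    S w                  ≈⟨ trans (rep w) (linRep-dim₁ ν μ η w) ⟩
    (a * P w) * b        ≈⟨ *-assoc _ _ _ ⟩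
    a * (P w * b)        ≈⟨ *-congˡ (*-comm _ _) ⟩
    a * (b * P w)        ≈⟨ sym (*-assoc _ _ _) ⟩
    (a * b) * P w        ≈⟨ *-congʳ (*-congʳ (sym (*-identityʳ a))) ⟩
    ((a * 1#) * b) * P w ≈⟨ *-congʳ (sym (trans (rep []) (linRep-dim₁ ν μ η []))) ⟩
    S [] * P w           ∎
    where
    open LinRep r
    a b : Carrier
    a = ν fzero fzero
    b = η fzero fzero
    P : Ser
    P = letterProduct (λ x → μ x fzero fzero)

  linRep₁⇔isLetterProduct : ∀ {S} → S [] ≈ 1# → LinRep 1 S ⇔ IsLetterProduct S
  linRep₁⇔isLetterProduct {S} S[]≈1 = mk⇔
    (λ r → (λ x → LinRep.μ r x fzero fzero) ,
           λ w → trans (linRep₁-scaled r w) (trans (*-congʳ S[]≈1) (*-identityˡ _)))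
    (λ (a , S≋) → record
      { ν   = λ _ _ → 1#
      ; μ   = λ x _ _ → a x
      ; η   = λ _ _ → 1#
      ; rep = λ w → trans (S≋ w) (sym (trans (linRep-dim₁ (λ _ _ → 1#) (λ x _ _ → a x) (λ _ _ → 1#) w)
                                            (trans (*-identityʳ _) (*-identityˡ _))))
      })

  inPlane⇔isLetterProduct : ∀ {L R} → L [] ≈ 0# → star L ≋ R
    → InPlane L ⇔ IsLetterProduct R
  inPlane⇔isLetterProduct {L} {R} L[]≈0 L*≋R = mk⇔
    (λ (a , L≋) → a , λ w → trans (sym (L*≋R w)) (trans (star-cong L≋ w) (star-planeSer a w)))
    (λ (a , R≋) → a , star-injective L[]≈0 refl
                        (λ w → trans (L*≋R w) (trans (R≋ w) (sym (star-planeSer a w)))))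

  inPlane⇔isInfConcChar : ∀ {L} → InPlane L ⇔ IsInfConcChar L
  inPlane⇔isInfConcChar {L} = mk⇔ toInf fromInf
    where
    toInf : InPlane L → IsInfConcChar L
    toInf (a , L≋) [] v =
      sym (trans (+-cong (trans (*-congʳ (L≋ [])) (zeroˡ _)) (*-identityˡ _)) (+-identityˡ _))
    toInf (a , L≋) (x ∷ []) [] =
      sym (trans (+-cong (*-identityʳ _) (zeroˡ _)) (+-identityʳ _))
    toInf (a , L≋) (x ∷ []) (y ∷ v) =
      trans (L≋ (x ∷ y ∷ v)) (sym (trans (+-cong (zeroʳ _) (zeroˡ _)) (+-identityʳ _)))
    toInf (a , L≋) (x ∷ y ∷ u) v =
      trans (L≋ (x ∷ y ∷ u ++ v))
        (sym (trans (+-cong (trans (*-congʳ (L≋ (x ∷ y ∷ u))) (zeroˡ _)) (zeroˡ _)) (+-identityʳ _)))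
    fromInf : IsInfConcChar L → InPlane L
    fromInf inf = (λ x → L (x ∷ [])) , L≋
      where
      L≋ : L ≋ planeSer (λ x → L (x ∷ []))
      L≋ []          = identityˡ-unique (L []) (L [])
                         (sym (trans (inf [] []) (+-cong (*-identityʳ _) (*-identityˡ _))))
      L≋ (x ∷ [])    = refl
      L≋ (x ∷ y ∷ w) = trans (inf (x ∷ []) (y ∷ w)) (trans (+-cong (zeroʳ _) (zeroˡ _)) (+-identityʳ _))

mainTheorem3 : ∀ {c ℓ : Level} (A : CommutativeRing c ℓ) (X : Set)
    → let open CommutativeRing A hiding (zero)
          open Series A X
      in
      (R L : Ser) → Rational R → Rational L
    → R [] ≈ 1# → L [] ≈ 0# → star L ≋ R
    → ((IsConcChar R ⇔ (Σ (X → Carrier) λ cx → R ≋ star (planeSer cx)))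
      × ((Σ (X → Carrier) λ cx → R ≋ star (planeSer cx)) ⇔ LinRep 1 R)
      × (LinRep 1 R ⇔ InPlane L)
      × (InPlane L ⇔ IsInfConcChar L))
mainTheorem3 A X R L _ _ R[]≈1 L[]≈0 L*≋R =
    ⇔.trans isConcChar⇔isLetterProduct (⇔.sym starOfPlane⇔isLetterProduct)
  , ⇔.trans starOfPlane⇔isLetterProduct (⇔.sym (linRep₁⇔isLetterProduct R[]≈1))
  , ⇔.trans (linRep₁⇔isLetterProduct R[]≈1) (⇔.sym (inPlane⇔isLetterProduct L[]≈0 L*≋R))
  , inPlane⇔isInfConcChar
  where open Characters A X
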